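{- Assume ${\sf par}$ is infinite. Let $\Gamma$ be a set of formulas closed under ${\sf par}$-substitutions and let $A\in\Gamma$. Then for every formula $B$ the following are equivalent: (1) $\vdash A\to B$; (2) $A\mathrel{|\!\sim_{\Gamma}} B$; (3) $A\mathrel{|\!\approx_{P_\Gamma}} B$, where $P_\Gamma$ is the set of $\Gamma$-projective formulas.
   Context: The language $\mathcal{L}$ is built from atoms ${\sf var}\cup{\sf par}$ (variables and parameters, disjoint infinite sets) using $\bot,\wedge,\vee,\to$; $\mathcal{L}({\sf par})$ is the set of formulas whose atoms are all parameters. A substitution is a map $\theta:\mathcal{L}\to\mathcal{L}$ commuting with connectives and fixing all parameters; a ${\sf par}$-substitution is a substitution sending every variable to a parameter; $\Gamma$ is closed under ${\sf par}$-substitutions if $\theta(C)\in\Gamma$ for every $C\in\Gamma$ and every ${\sf par}$-substitution $\theta$. $\vdash$ is intuitionistic derivability. A formula $F$ is $E$-projective ($E\in\mathcal{L}({\sf par})$) if there is $\theta$ with $F\vdash\theta(a)\leftrightarrow a$ for every atom $a$ and $\vdash\theta(F)\leftrightarrow E$; $F$ is $\Gamma$-projective if it is $E$-projective for some $E\in\Gamma\cap\mathcal{L}({\sf par})$. $A\mathrel{|\!\sim_{\Gamma}} B$ means: for every $E\in\Gamma\cap\mathcal{L}({\sf par})$ and every substitution $\theta$, if $\vdash E\to\theta(A)$ then $\vdash E\to\theta(B)$. For a set $\Delta$, $A\mathrel{|\!\approx_{\Delta}} B$ means: for every $F\in\Delta$, $\vdash F\to A$ implies $\vdash F\to B$. 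-}

module Defs where

open import Data.Nat using (ℕ)
open import Data.List using (List; []; _∷_)
open import Data.List.Membership.Propositional using (_∈_)
open import Data.Product using (Σ; ∃; _×_; _,_)
open import Relation.Binary.PropositionalEquality using (_≡_)

data Atom : Set where
  var : ℕ → Atom
  par : ℕ → Atom

data Formula : Set where
  atom : Atom → Formula
  ⊥'   : Formula
  _∧'_ : Formula → Formula → Formula
  _∨'_ : Formula → Formula → Formula
  _⇒_  : Formula → Formula → Formula

infixr 6 _∧'_
infixr 5 _∨'_
infixr 4 _⇒_
infix 3 _⇔'_

_⇔'_ : Formula → Formula → Formula
A ⇔' B = (A ⇒ B) ∧' (B ⇒ A)

data InLpar : Formula → Set where
  par-at : ∀ n → InLpar (atom (par n))
  ⊥-at   : InLpar ⊥'
  ∧-par  : ∀ {A B} → InLpar A → InLpar B → InLpar (A ∧' B)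
  ∨-par  : ∀ {A B} → InLpar A → InLpar B → InLpar (A ∨' B)
  ⇒-par  : ∀ {A B} → InLpar A → InLpar B → InLpar (A ⇒ B)

infix 2 _⊢_
data _⊢_ (Δ : List Formula) : Formula → Set where
  hyp  : ∀ {A} → A ∈ Δ → Δ ⊢ A
  ⊥E   : ∀ {A} → Δ ⊢ ⊥' → Δ ⊢ A
  ∧I   : ∀ {A B} → Δ ⊢ A → Δ ⊢ B → Δ ⊢ A ∧' B
  ∧E₁  : ∀ {A B} → Δ ⊢ A ∧' B → Δ ⊢ A
  ∧E₂  : ∀ {A B} → Δ ⊢ A ∧' B → Δ ⊢ B
  ∨I₁  : ∀ {A B} → Δ ⊢ A → Δ ⊢ A ∨' B
  ∨I₂  : ∀ {A B} → Δ ⊢ B → Δ ⊢ A ∨' B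
  ∨E   : ∀ {A B C} → Δ ⊢ A ∨' B → (A ∷ Δ) ⊢ C → (B ∷ Δ) ⊢ C → Δ ⊢ C
  ⇒I   : ∀ {A B} → (A ∷ Δ) ⊢ B → Δ ⊢ A ⇒ B
  ⇒E   : ∀ {A B} → Δ ⊢ A ⇒ B → Δ ⊢ A → Δ ⊢ B

infix 2 ⊢_
⊢_ : Formula → Set
⊢ A = [] ⊢ A

Subst : Set
Subst = ℕ → Formula

substAtom : Subst → Atom → Formula
substAtom θ (var n) = θ n
substAtom θ (par n) = atom (par n)

subst : Subst → Formula → Formula
subst θ (atom a) = substAtom θ a
subst θ ⊥'       = ⊥'
subst θ (A ∧' B) = subst θ A ∧' subst θ B
subst θ (A ∨' B) = subst θ A ∨' subst θ B
subst θ (A ⇒ B)  = subst θ A ⇒ subst θ B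

IsParSubst : Subst → Set
IsParSubst θ = ∀ n → ∃ λ m → θ n ≡ atom (par m)

FormulaSet : Set₁
FormulaSet = Formula → Set

ClosedUnderParSubst : FormulaSet → Set
ClosedUnderParSubst Γ = ∀ C θ → Γ C → IsParSubst θ → Γ (subst θ C)

IsProjectiveFor : Formula → Formula → Set
IsProjectiveFor E F =
  Σ Subst λ θ → (∀ (a : Atom) → (F ∷ []) ⊢ subst θ (atom a) ⇔' atom a)
              × (⊢ subst θ F ⇔' E)

IsΓProjective : FormulaSet → Formula → Set
IsΓProjective Γ F = Σ Formula λ E → Γ E × InLpar E × IsProjectiveFor E F

ProjSet : FormulaSet → FormulaSet
ProjSet Γ = IsΓProjective Γ

infix 1 _|∼[_]_ _|≈[_]_
_|∼[_]_ : Formula → FormulaSet → Formula → Set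
A |∼[ Γ ] B = ∀ E → Γ E → InLpar E → ∀ (θ : Subst) →
              ⊢ E ⇒ subst θ A → ⊢ E ⇒ subst θ B

_|≈[_]_ : Formula → FormulaSet → Formula → Set
A |≈[ Δ ] B = ∀ F → Δ F → ⊢ F ⇒ A → ⊢ F ⇒ B

-- (1) ⇒ (2) is stability of derivability under substitution. For (2) ⇒ (3), a projective
-- formula F with unifier θ proves θ(C) ↔ C for every C, so a derivation of F → A transported
-- along θ and E ↔ θ(F) lands in the premise of |∼_Γ. For (3) ⇒ (1), pick N above every atom
-- index of A and B and take F = A ∧ ⋀_{k<N} (p_{N+k} ↔ x_k): freezing x_k to p_{N+k} unifies
-- it with a par-instance of A (which lies in Γ), so F is Γ-projective; and F → A gives F → B,
-- from which renaming p_{N+k} back to x_k (an atom renaming that fixes A and B and makes the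
-- big conjunction derivable) recovers A → B.
module Submission where

open import Defs
open import Data.Product using (_×_; _,_)
open import Function.Bundles using (_⇔_; mk⇔)
open import Function using (_∘_)
open import Data.Nat using (ℕ; zero; suc; _+_; _∸_; _⊔_; _<_; _≤?_; _<?_; s≤s)
open import Data.Nat.Properties
  using (m≤m⊔n; m≤n⊔m; m⊔n<o⇒m<o; m⊔n<o⇒n<o; m≤m+n; m+n∸m≡n; <⇒≱; n<1+n; m<n⇒m<1+n; m<1+n⇒m<n∨m≡n)
open import Data.List using (List; []; _∷_; map)
open import Data.List.Membership.Propositional.Properties using (∈-map⁺)
open import Data.List.Relation.Binary.Subset.Propositional using (_⊆_)
open import Data.List.Relation.Binary.Subset.Propositional.Properties using (xs⊆x∷xs; ∷⁺ʳ)
open import Data.List.Relation.Unary.Any using (here)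
open import Data.Sum using (inj₁; inj₂)
open import Relation.Nullary using (yes; no; contradiction)
open import Relation.Binary.PropositionalEquality as ≡ using (_≡_; refl; cong; cong₂; sym; trans)

private
  variable
    Δ Δ′ : List Formula
    A B C X X′ Y Y′ : Formula

weaken : Δ ⊆ Δ′ → Δ ⊢ C → Δ′ ⊢ C
weaken s (hyp p)     = hyp (s p)
weaken s (⊥E d)      = ⊥E (weaken s d)
weaken s (∧I d e)    = ∧I (weaken s d) (weaken s e)
weaken s (∧E₁ d)     = ∧E₁ (weaken s d)
weaken s (∧E₂ d)     = ∧E₂ (weaken s d)
weaken s (∨I₁ d)     = ∨I₁ (weaken s d)
weaken s (∨I₂ d)     = ∨I₂ (weaken s d)
weaken s (∨E d e f)  = ∨E (weaken s d) (weaken (∷⁺ʳ _ s) e) (weaken (∷⁺ʳ _ s) f)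
weaken s (⇒I d)      = ⇒I (weaken (∷⁺ʳ _ s) d)
weaken s (⇒E d e)    = ⇒E (weaken s d) (weaken s e)

weaken₁ : Δ ⊢ C → (A ∷ Δ) ⊢ C
weaken₁ = weaken (xs⊆x∷xs _ _)

weaken-[] : ⊢ C → Δ ⊢ C
weaken-[] = weaken (λ ())

hyp₀ : (A ∷ Δ) ⊢ A
hyp₀ = hyp (here refl)

⇒-trans : ⊢ A ⇒ B → ⊢ B ⇒ C → ⊢ A ⇒ C
⇒-trans d e = ⇒I (⇒E (weaken₁ e) (⇒E (weaken₁ d) hyp₀))

⇔-refl : Δ ⊢ X ⇔' X
⇔-refl = ∧I (⇒I hyp₀) (⇒I hyp₀)

⇔-sym : Δ ⊢ X ⇔' Y → Δ ⊢ Y ⇔' X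
⇔-sym d = ∧I (∧E₂ d) (∧E₁ d)

⇔-mp : Δ ⊢ X ⇔' Y → Δ ⊢ X → Δ ⊢ Y
⇔-mp d = ⇒E (∧E₁ d)

∧-cong : Δ ⊢ X ⇔' X′ → Δ ⊢ Y ⇔' Y′ → Δ ⊢ X ∧' Y ⇔' X′ ∧' Y′
∧-cong d e = ∧I (one d e) (one (⇔-sym d) (⇔-sym e))
  where
  one : Δ ⊢ X ⇔' X′ → Δ ⊢ Y ⇔' Y′ → Δ ⊢ X ∧' Y ⇒ X′ ∧' Y′
  one d e = ⇒I (∧I (⇔-mp (weaken₁ d) (∧E₁ hyp₀)) (⇔-mp (weaken₁ e) (∧E₂ hyp₀)))

∨-cong : Δ ⊢ X ⇔' X′ → Δ ⊢ Y ⇔' Y′ → Δ ⊢ X ∨' Y ⇔' X′ ∨' Y′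
∨-cong d e = ∧I (one d e) (one (⇔-sym d) (⇔-sym e))
  where
  one : Δ ⊢ X ⇔' X′ → Δ ⊢ Y ⇔' Y′ → Δ ⊢ X ∨' Y ⇒ X′ ∨' Y′
  one d e = ⇒I (∨E hyp₀ (∨I₁ (⇔-mp (weaken₁ (weaken₁ d)) hyp₀))
                        (∨I₂ (⇔-mp (weaken₁ (weaken₁ e)) hyp₀)))

⇒-cong : Δ ⊢ X ⇔' X′ → Δ ⊢ Y ⇔' Y′ → Δ ⊢ (X ⇒ Y) ⇔' (X′ ⇒ Y′)
⇒-cong d e = ∧I (one d e) (one (⇔-sym d) (⇔-sym e))
  where
  one : Δ ⊢ X ⇔' X′ → Δ ⊢ Y ⇔' Y′ → Δ ⊢ (X ⇒ Y) ⇒ (X′ ⇒ Y′)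
  one d e = ⇒I (⇒I (⇔-mp (weaken₁ (weaken₁ e))
                    (⇒E (weaken₁ hyp₀) (⇔-mp (weaken₁ (weaken₁ (⇔-sym d))) hyp₀))))

-- Arbitrary atom renamings; unlike a Subst, these may move parameters.
gsub : (Atom → Formula) → Formula → Formula
gsub f (atom a) = f a
gsub f ⊥'       = ⊥'
gsub f (A ∧' B) = gsub f A ∧' gsub f B
gsub f (A ∨' B) = gsub f A ∨' gsub f B
gsub f (A ⇒ B)  = gsub f A ⇒ gsub f B

subst≡gsub : ∀ θ C → subst θ C ≡ gsub (substAtom θ) C
subst≡gsub θ (atom a) = refl
subst≡gsub θ ⊥'       = refl
subst≡gsub θ (A ∧' B) = cong₂ _∧'_ (subst≡gsub θ A) (subst≡gsub θ B)
subst≡gsub θ (A ∨' B) = cong₂ _∨'_ (subst≡gsub θ A) (subst≡gsub θ B)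
subst≡gsub θ (A ⇒ B)  = cong₂ _⇒_ (subst≡gsub θ A) (subst≡gsub θ B)

gsub-⊢ : ∀ f → Δ ⊢ C → map (gsub f) Δ ⊢ gsub f C
gsub-⊢ f (hyp p)    = hyp (∈-map⁺ (gsub f) p)
gsub-⊢ f (⊥E d)     = ⊥E (gsub-⊢ f d)
gsub-⊢ f (∧I d e)   = ∧I (gsub-⊢ f d) (gsub-⊢ f e)
gsub-⊢ f (∧E₁ d)    = ∧E₁ (gsub-⊢ f d)
gsub-⊢ f (∧E₂ d)    = ∧E₂ (gsub-⊢ f d)
gsub-⊢ f (∨I₁ d)    = ∨I₁ (gsub-⊢ f d)
gsub-⊢ f (∨I₂ d)    = ∨I₂ (gsub-⊢ f d)
gsub-⊢ f (∨E d e g) = ∨E (gsub-⊢ f d) (gsub-⊢ f e) (gsub-⊢ f g)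
gsub-⊢ f (⇒I d)     = ⇒I (gsub-⊢ f d)
gsub-⊢ f (⇒E d e)   = ⇒E (gsub-⊢ f d) (gsub-⊢ f e)

subst-⊢ : ∀ θ → ⊢ C → ⊢ subst θ C
subst-⊢ {C} θ d = ≡.subst ⊢_ (sym (subst≡gsub θ C)) (gsub-⊢ (substAtom θ) d)

atomIndex : Atom → ℕ
atomIndex (var n) = n
atomIndex (par n) = n

bound : Formula → ℕ
bound (atom a) = atomIndex a
bound ⊥'       = 0
bound (A ∧' B) = bound A ⊔ bound B
bound (A ∨' B) = bound A ⊔ bound B
bound (A ⇒ B)  = bound A ⊔ bound B

gsub-cong : ∀ {N f g} C → bound C < N → (∀ a → atomIndex a < N → f a ≡ g a) →
            gsub f C ≡ gsub g C
gsub-cong (atom a) b f≗g = f≗g a b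
gsub-cong ⊥'       b f≗g = refl
gsub-cong (A ∧' B) b f≗g =
  cong₂ _∧'_ (gsub-cong A (m⊔n<o⇒m<o _ _ b) f≗g) (gsub-cong B (m⊔n<o⇒n<o _ _ b) f≗g)
gsub-cong (A ∨' B) b f≗g =
  cong₂ _∨'_ (gsub-cong A (m⊔n<o⇒m<o _ _ b) f≗g) (gsub-cong B (m⊔n<o⇒n<o _ _ b) f≗g)
gsub-cong (A ⇒ B)  b f≗g =
  cong₂ _⇒_ (gsub-cong A (m⊔n<o⇒m<o _ _ b) f≗g) (gsub-cong B (m⊔n<o⇒n<o _ _ b) f≗g)

gsub-atom : ∀ C → gsub atom C ≡ C
gsub-atom (atom a) = refl
gsub-atom ⊥'       = refl
gsub-atom (A ∧' B) = cong₂ _∧'_ (gsub-atom A) (gsub-atom B)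
gsub-atom (A ∨' B) = cong₂ _∨'_ (gsub-atom A) (gsub-atom B)
gsub-atom (A ⇒ B)  = cong₂ _⇒_ (gsub-atom A) (gsub-atom B)

subst-InLpar : ∀ {θ} → IsParSubst θ → ∀ C → InLpar (subst θ C)
subst-InLpar {θ} isPar (atom (var n)) with θ n | isPar n
... | _ | m , refl = par-at m
subst-InLpar isPar (atom (par n)) = par-at n
subst-InLpar isPar ⊥'             = ⊥-at
subst-InLpar isPar (A ∧' B)       = ∧-par (subst-InLpar isPar A) (subst-InLpar isPar B)
subst-InLpar isPar (A ∨' B)       = ∨-par (subst-InLpar isPar A) (subst-InLpar isPar B)
subst-InLpar isPar (A ⇒ B)        = ⇒-par (subst-InLpar isPar A) (subst-InLpar isPar B)

subst-⇔ : ∀ θ → (∀ a → Δ ⊢ subst θ (atom a) ⇔' atom a) → ∀ C → Δ ⊢ subst θ C ⇔' C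
subst-⇔ θ fixes (atom a) = fixes a
subst-⇔ θ fixes ⊥'       = ⇔-refl
subst-⇔ θ fixes (A ∧' B) = ∧-cong (subst-⇔ θ fixes A) (subst-⇔ θ fixes B)
subst-⇔ θ fixes (A ∨' B) = ∨-cong (subst-⇔ θ fixes A) (subst-⇔ θ fixes B)
subst-⇔ θ fixes (A ⇒ B)  = ⇒-cong (subst-⇔ θ fixes A) (subst-⇔ θ fixes B)

⋀ : (ℕ → Formula) → ℕ → Formula
⋀ φ zero    = ⊥' ⇒ ⊥'
⋀ φ (suc n) = ⋀ φ n ∧' φ n

⋀-intro : ∀ {φ} n → (∀ k → k < n → Δ ⊢ φ k) → Δ ⊢ ⋀ φ n
⋀-intro zero    prems = ⇒I hyp₀
⋀-intro (suc n) prems = ∧I (⋀-intro n (λ k k<n → prems k (m<n⇒m<1+n k<n))) (prems n (n<1+n n))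

⋀-elim : ∀ {φ n k} → Δ ⊢ ⋀ φ n → k < n → Δ ⊢ φ k
⋀-elim {n = suc n} d k<1+n with m<1+n⇒m<n∨m≡n k<1+n
... | inj₁ k<n = ⋀-elim (∧E₁ d) k<n
... | inj₂ refl = ∧E₂ d

gsub-⋀ : ∀ f φ n → gsub f (⋀ φ n) ≡ ⋀ (gsub f ∘ φ) n
gsub-⋀ f φ zero    = refl
gsub-⋀ f φ (suc n) = cong (_∧' gsub f (φ n)) (gsub-⋀ f φ n)

⊢-gsub-⋀ : ∀ f φ n → (∀ k → k < n → ⊢ gsub f (φ k)) → ⊢ gsub f (⋀ φ n)
⊢-gsub-⋀ f φ n prems = ≡.subst ⊢_ (sym (gsub-⋀ f φ n)) (⋀-intro n prems)

module Freeze (N : ℕ) where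

  links : Formula
  links = ⋀ (λ k → atom (par (N + k)) ⇔' atom (var k)) N

  shift : Subst
  shift n = atom (par (N + n))

  freeze : Subst
  freeze n with n <? N
  ... | yes _ = atom (par (N + n))
  ... | no _  = atom (var n)

  thaw : Atom → Formula
  thaw (var n) = atom (var n)
  thaw (par m) with N ≤? m
  ... | yes _ = atom (var (m ∸ N))
  ... | no _  = atom (par m)

  freeze-below : ∀ {n} → n < N → freeze n ≡ atom (par (N + n))
  freeze-below {n} n<N with n <? N
  ... | yes _   = refl
  ... | no n≮N = contradiction n<N n≮N

  thaw-below : ∀ a → atomIndex a < N → thaw a ≡ atom a
  thaw-below (var n) _   = refl
  thaw-below (par m) m<N with N ≤? m
  ... | yes N≤m = contradiction N≤m (<⇒≱ m<N)
  ... | no _    = refl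

  thaw-shift : ∀ k → thaw (par (N + k)) ≡ atom (var k)
  thaw-shift k with N ≤? N + k
  ... | yes _    = cong (atom ∘ var) (m+n∸m≡n N k)
  ... | no N≰N+k = contradiction (m≤m+n N k) N≰N+k

  freeze≡shift : ∀ C → bound C < N → subst freeze C ≡ subst shift C
  freeze≡shift C b = begin
    subst freeze C                  ≡⟨ subst≡gsub freeze C ⟩
    gsub (substAtom freeze) C       ≡⟨ gsub-cong C b agree ⟩
    gsub (substAtom shift) C        ≡⟨ sym (subst≡gsub shift C) ⟩
    subst shift C                   ∎
    where
    open ≡.≡-Reasoning
    agree : ∀ a → atomIndex a < N → substAtom freeze a ≡ substAtom shift a
    agree (var n) n<N = freeze-below n<N
    agree (par m) _   = refl

  thaw-fixes : ∀ C → bound C < N → gsub thaw C ≡ C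
  thaw-fixes C b = trans (gsub-cong C b thaw-below) (gsub-atom C)

  freeze-atom : Δ ⊢ links → ∀ a → Δ ⊢ subst freeze (atom a) ⇔' atom a
  freeze-atom d (par m) = ⇔-refl
  freeze-atom d (var n) with n <? N
  ... | yes n<N = ⋀-elim d n<N
  ... | no _    = ⇔-refl

  ⊢-freeze-links : ⊢ subst freeze links
  ⊢-freeze-links = ≡.subst ⊢_ (sym (subst≡gsub freeze links))
    (⊢-gsub-⋀ (substAtom freeze) _ N λ k k<N → ≡.subst (λ P → ⊢ atom (par (N + k)) ⇔' P)
      (sym (freeze-below k<N)) ⇔-refl)

  ⊢-thaw-links : ⊢ gsub thaw links
  ⊢-thaw-links = ⊢-gsub-⋀ thaw _ N λ k _ → ≡.subst (λ P → ⊢ P ⇔' atom (var k))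
    (sym (thaw-shift k)) ⇔-refl

  frozen-projective : ∀ {Γ} → ClosedUnderParSubst Γ → Γ A → bound A < N →
                      IsΓProjective Γ (A ∧' links)
  frozen-projective {A} cl ΓA b =
    subst shift A , cl A shift ΓA shift-isPar , subst-InLpar shift-isPar A ,
    freeze , freeze-atom (∧E₂ hyp₀) , unified
    where
    shift-isPar : IsParSubst shift
    shift-isPar n = N + n , refl
    unified : ⊢ subst freeze (A ∧' links) ⇔' subst shift A
    unified rewrite freeze≡shift A b =
      ∧I (⇒I (∧E₁ hyp₀)) (⇒I (∧I hyp₀ (weaken-[] ⊢-freeze-links)))

  thaw-⊢ : bound A < N → bound C < N → ⊢ A ∧' links ⇒ C → ⊢ A ⇒ C
  thaw-⊢ {A} {C} bA bC d = ⇒I (⇒E (weaken₁ thawed) (∧I hyp₀ (weaken-[] ⊢-thaw-links)))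
    where
    thawed : ⊢ A ∧' gsub thaw links ⇒ C
    thawed = ≡.subst ⊢_ (cong₂ (λ P Q → P ∧' gsub thaw links ⇒ Q) (thaw-fixes A bA) (thaw-fixes C bC))
                    (gsub-⊢ thaw d)

⊢⇒|∼ : ∀ Γ → ⊢ A ⇒ B → A |∼[ Γ ] B
⊢⇒|∼ Γ d E _ _ θ e = ⇒-trans e (subst-⊢ θ d)

|∼⇒|≈ : ∀ Γ → A |∼[ Γ ] B → A |≈[ ProjSet Γ ] B
|∼⇒|≈ {A} {B} Γ h F (E , ΓE , E-par , θ , fixes , θF⇔E) F⇒A =
  ⇒I (⇔-mp (subst-⇔ θ fixes B) (⇒E (weaken₁ θF⇒θB) (⇔-mp (⇔-sym (subst-⇔ θ fixes F)) hyp₀)))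
  where
  θF⇒θB : ⊢ subst θ F ⇒ subst θ B
  θF⇒θB = ⇒-trans (∧E₁ θF⇔E) (h E ΓE E-par θ (⇒-trans (∧E₂ θF⇔E) (subst-⊢ θ F⇒A)))

|≈⇒⊢ : ∀ {Γ} → ClosedUnderParSubst Γ → Γ A → A |≈[ ProjSet Γ ] B → ⊢ A ⇒ B
|≈⇒⊢ {A} {B} cl ΓA h = thaw-⊢ bA bB (h (A ∧' links) (frozen-projective cl ΓA bA) (⇒I (∧E₁ hyp₀)))
  where
  open Freeze (suc (bound A ⊔ bound B))
  bA : bound A < suc (bound A ⊔ bound B)
  bA = s≤s (m≤m⊔n (bound A) (bound B))
  bB : bound B < suc (bound A ⊔ bound B)
  bB = s≤s (m≤n⊔m (bound A) (bound B))

lemma6p3 : (Γ : FormulaSet) → ClosedUnderParSubst Γ →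
    (A : Formula) → Γ A → (B : Formula) →
    ((⊢ A ⇒ B) ⇔ (A |∼[ Γ ] B)) × ((A |∼[ Γ ] B) ⇔ (A |≈[ ProjSet Γ ] B))
lemma6p3 Γ cl A ΓA B =
  mk⇔ (⊢⇒|∼ Γ) (|≈⇒⊢ cl ΓA ∘ |∼⇒|≈ Γ) ,
  mk⇔ (|∼⇒|≈ Γ) (⊢⇒|∼ Γ ∘ |≈⇒⊢ cl ΓA)
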